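{- Let $k\geq 1$ and let $\tau\in S_k(312)$ have normal form $\tau=\tau^{(0)}m_0\tau^{(1)}m_1\cdots\tau^{(r)}m_r$. For $-1\leq j\leq r$ let $\Theta^{(j)}$ be the $j$-th prefix of $\tau$ (with $\Theta^{(-1)}=\emptyset$), and for $0\leq j\leq r$ let $\Theta^{<j>}$ be the $j$-th suffix of $\tau$. Let $\sigma$ be a $312$-avoiding permutation of $[n]$, $n\geq1$, written as $\sigma=\sigma'1\sigma''$ (where $\sigma',\sigma''$ are the, possibly empty, subsequences before and after the entry $1$). Then $\sigma$ avoids $\tau$ if and only if there exists $i$ with $0\leq i\leq r$ such that $\sigma'1$ avoids $\Theta^{(i)}$ and contains $\Theta^{(i-1)}$, while $\sigma''$ avoids $\Theta^{<i>}$.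
   Context: $S_n$ is the set of permutations of $[n]=\{1,\dots,n\}$. For a sequence $w=w_1\cdots w_m$ of distinct integers, its reduced form is the permutation $v\in S_m$ with $v_i=\ell$ iff $w_i$ is the $\ell$-th smallest entry of $w$. A permutation $\tau\in S_k$ appears as a pattern in a sequence $\sigma$ of distinct integers if some subsequence of $\sigma$ of length $k$ has reduced form $\tau$; otherwise $\sigma$ avoids $\tau$. A sequence $w$ (not necessarily a permutation) is said to be avoided/contained according to its reduced form. Every sequence contains the empty pattern $\emptyset$. $S_n(T)$ denotes the set of permutations in $S_n$ avoiding every pattern in $T$. For sequences $w^1,w^2$, $w^1<w^2$ means every entry of $w^1$ is smaller than every entry of $w^2$. An entry $\tau_i$ is a right-to-left minimum if $\tau_i<\tau_j$ for all $j>i$. If $m_0=1<m_1<\dots<m_r$ are the right-to-left minima of $\tau\in S_k(312)$ from left to right, then $\tau=\tau^{(0)}m_0\tau^{(1)}m_1\cdots\tau^{(r)}m_r$ with $m_0<\tau^{(0)}<m_1<\tau^{(1)}<\cdots<m_r<\tau^{(r)}$, each $\tau^{(j)}$ a possibly empty $312$-avoiding sequence; this is the normal form of $\tau$. The $j$-th prefix is $\Theta^{(j)}=\tau^{(0)}m_0\tau^{(1)}m_1\cdots\tau^{(j)}m_j$, and the $j$-th suffix $\Theta^{<j>}$ is the reduced form of $\tau^{(j)}m_j\tau^{(j+1)}m_{j+1}\cdots\tau^{(r)}m_r$. -}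

module Defs where

open import Data.Nat using (ℕ; zero; suc; _<ᵇ_; _≤ᵇ_)
open import Data.Bool using (Bool; true; false; if_then_else_)
open import Data.List using (List; []; _∷_; _++_; map; length; filter; reverse; concat; take; drop; applyUpTo)
open import Data.List.Relation.Binary.Sublist.Propositional using (_⊆_)
open import Data.List.Relation.Binary.Permutation.Propositional using (_↭_)
open import Data.Product using (Σ; _×_)
open import Relation.Binary.PropositionalEquality using (_≡_)
open import Relation.Nullary using (¬_)

countLeq : ℕ → List ℕ → ℕ
countLeq x []       = zero
countLeq x (y ∷ ys) = if y ≤ᵇ x then suc (countLeq x ys) else countLeq x ys

-- reduced form: for sequences of distinct integers, entry i becomes the
-- rank ℓ of w_i among the entries of w
red : List ℕ → List ℕ
red w = map (λ x → countLeq x w) w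

IsPerm : ℕ → List ℕ → Set
IsPerm n σ = σ ↭ applyUpTo suc n

Contains : List ℕ → List ℕ → Set
Contains σ w = Σ (List ℕ) λ u → (u ⊆ σ) × (red u ≡ red w)

Avoids : List ℕ → List ℕ → Set
Avoids σ w = ¬ Contains σ w

p312 : List ℕ
p312 = 3 ∷ 1 ∷ 2 ∷ []

isRLMin : ℕ → List ℕ → Bool
isRLMin x []       = true
isRLMin x (y ∷ ys) = if x <ᵇ y then isRLMin x ys else false

-- split τ into the blocks τ^(0) m_0, τ^(1) m_1, …, τ^(r) m_r,
-- cutting right after each right-to-left minimum
blocksAux : List ℕ → List ℕ → List (List ℕ)
blocksAux acc []       = []
blocksAux acc (x ∷ xs) =
  if isRLMin x xs then reverse (x ∷ acc) ∷ blocksAux [] xs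
  else blocksAux (x ∷ acc) xs

blocks : List ℕ → List (List ℕ)
blocks τ = blocksAux [] τ

-- prefixTo j τ = Θ^(j-1) = τ^(0) m_0 ⋯ τ^(j-1) m_(j-1)   (prefixTo 0 τ = ∅ = Θ^(-1))
prefixTo : ℕ → List ℕ → List ℕ
prefixTo j τ = concat (take j (blocks τ))

-- suffix j τ = Θ^<j> = reduced form of τ^(j) m_j ⋯ τ^(r) m_r
suffix : ℕ → List ℕ → List ℕ
suffix j τ = red (concat (drop j (blocks τ)))

-- Write σ = P σ'' with P = σ'1. As σ avoids 312 and 1 is its least entry, every entry of P lies below
-- every entry of σ''; for the same reason every prefix Θ^(j-1) of the normal form of τ lies below the
-- remaining blocks. Hence an occurrence of τ in P σ'' splits into an occurrence of some Θ^(j-1) in P and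
-- of Θ^<j> in σ'': the lower part of τ ends in an entry below everything after it, i.e. at a right-to-left
-- minimum, which is a block boundary. Conversely two such occurrences glue to one of τ. Containment of
-- Θ^(j-1) in P is decidable, holds for j = 0 and fails for j = r + 1 when σ avoids τ, so there is a last
-- j = i where it holds; since Θ^(j-1) grows and Θ^<j> shrinks with j, the two characterisations agree.

module Submission where

open import Defs
open import Data.Nat using (ℕ; zero; suc; _≤_; _<_; _≤ᵇ_; _<ᵇ_; _≤?_; _≟_; z≤n; s≤s)
open import Data.Nat.Properties
  using (≤ᵇ-reflects-≤; <ᵇ-reflects-<; ≤-trans; ≤-refl; <-trans; <⇒≤; <⇒≱; <⇒≢; ≰⇒>; ≤∧≢⇒<;
         m≤n⇒m≤1+n; suc-injective; <-cmp)
open import Data.Bool using (true; false)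
open import Data.Empty using (⊥-elim)
open import Data.Sum using (_⊎_; inj₁; inj₂)
open import Data.Product using (Σ; ∃-syntax; _×_; _,_; proj₁; proj₂; swap)
open import Data.List using (List; []; _∷_; _++_; length; map; concat; take; drop; reverse; initLast; _∷ʳ′_)
open import Data.List.Properties
  using (++-assoc; ++-identityʳ; ++-cancelˡ; unfold-reverse; concat-++; take++drop≡id; take-all;
         map-++; map-∘; map-id; map-cong-local; ≡-dec)
open import Data.List.Membership.Propositional using (_∈_)
open import Data.List.Membership.Propositional.Properties
  using (∈-++⁺ˡ; ∈-++⁺ʳ; ∈-++⁻; ∈-map⁺; ∈-map⁻; ∈-applyUpTo⁻)
open import Data.List.Relation.Unary.All as All using (All; []; _∷_)
import Data.List.Relation.Unary.All.Properties as All
open import Data.List.Relation.Unary.Any using (here; there)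
open import Data.List.Relation.Unary.Unique.Propositional using (Unique; _∷_)
open import Data.List.Relation.Unary.Unique.Propositional.Properties using (applyUpTo⁺₁)
open import Data.List.Relation.Binary.Permutation.Propositional using (↭⇒↭ₛ; ↭-sym)
open import Data.List.Relation.Binary.Permutation.Propositional.Properties using (∈-resp-↭)
open import Data.List.Relation.Binary.Permutation.Setoid.Properties using (Unique-resp-↭)
open import Data.List.Relation.Binary.Sublist.Propositional
  using (_⊆_; []; _∷_; _∷ʳ_; ⊆-refl; ⊆-trans; ⊆-reflexive; lookup; from∈)
open import Data.List.Relation.Binary.Sublist.Propositional.Properties
  using ([]⊆-universal; ++⁺; ++⁺ˡ; ++⁺ʳ; take⁺; drop⁺-≥)
open import Function using (_∘_; id; case_of_)
open import Function.Bundles using (_⇔_; mk⇔; Equivalence)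
open import Relation.Nullary using (¬_; Dec; yes; no; contradiction)
open import Relation.Nullary.Reflects using (ofʸ; ofⁿ)
open import Relation.Binary.Definitions using (tri<; tri≈; tri>)
open import Relation.Binary.PropositionalEquality
  using (_≡_; _≢_; refl; sym; trans; cong; subst; setoid; module ≡-Reasoning)

-- Order-compatible matchings

SameOrder : ℕ × ℕ → ℕ × ℕ → Set
SameOrder p q = (proj₁ p ≤ proj₁ q → proj₂ p ≤ proj₂ q) × (proj₂ p ≤ proj₂ q → proj₁ p ≤ proj₁ q)

SameOrder-refl : ∀ {p} → SameOrder p p
SameOrder-refl = (λ _ → ≤-refl) , (λ _ → ≤-refl)

SameOrder-trans : ∀ {a b c a' b' c'} →
                  SameOrder (a , b) (a' , b') → SameOrder (b , c) (b' , c') → SameOrder (a , c) (a' , c')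
SameOrder-trans (f , f⁻) (g , g⁻) = g ∘ f , f⁻ ∘ g⁻

SameOrder-< : ∀ {p q} → proj₁ p < proj₁ q → proj₂ p < proj₂ q → SameOrder p q
SameOrder-< p₁<q₁ p₂<q₂ = (λ _ → <⇒≤ p₂<q₂) , (λ _ → <⇒≤ p₁<q₁)

SameOrder-> : ∀ {p q} → proj₁ q < proj₁ p → proj₂ q < proj₂ p → SameOrder p q
SameOrder-> q₁<p₁ q₂<p₂ = ⊥-elim ∘ <⇒≱ q₁<p₁ , ⊥-elim ∘ <⇒≱ q₂<p₂

OrderCompatible : List (ℕ × ℕ) → Set
OrderCompatible Z = ∀ {p q} → p ∈ Z → q ∈ Z → SameOrder p q

-- An occurrence of w in σ as a matching of entries of σ (first components) with the entries
-- of w itself (second components), not with its reduced form; this is what makes occurrences compose.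
record Occurrence (σ w : List ℕ) : Set where
  constructor occurrence
  field
    pairs      : List (ℕ × ℕ)
    entries⊆   : map proj₁ pairs ⊆ σ
    pattern≡   : map proj₂ pairs ≡ w
    compatible : OrderCompatible pairs

Occurrence-⊆ : ∀ {σ σ' w} → σ ⊆ σ' → Occurrence σ w → Occurrence σ' w
Occurrence-⊆ σ⊆σ' (occurrence Z Z⊆σ Z≡w c) = occurrence Z (⊆-trans Z⊆σ σ⊆σ') Z≡w c

map-occurrence : ∀ (g h : ℕ → ℕ) w → (∀ {x y} → x ∈ w → y ∈ w → SameOrder (g x , h x) (g y , h y)) →
                 Occurrence (map g w) (map h w)
map-occurrence g h w same =
  occurrence (map (λ x → g x , h x) w) (⊆-reflexive (sym (map-∘ w))) (sym (map-∘ w)) compatible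
  where
  compatible : OrderCompatible (map (λ x → g x , h x) w)
  compatible p∈ q∈ with ∈-map⁻ _ p∈ | ∈-map⁻ _ q∈
  ... | x , x∈w , refl | y , y∈w , refl = same x∈w y∈w

rank : List ℕ → ℕ → ℕ
rank w x = countLeq x w

countLeq-mono-≤ : ∀ w {x y} → x ≤ y → countLeq x w ≤ countLeq y w
countLeq-mono-≤ [] _ = z≤n
countLeq-mono-≤ (z ∷ w) {x} {y} x≤y with z ≤ᵇ x | ≤ᵇ-reflects-≤ z x | z ≤ᵇ y | ≤ᵇ-reflects-≤ z y
... | true  | _       | true  | _       = s≤s (countLeq-mono-≤ w x≤y)
... | true  | ofʸ z≤x | false | ofⁿ z≰y = contradiction (≤-trans z≤x x≤y) z≰y
... | false | _       | true  | _       = m≤n⇒m≤1+n (countLeq-mono-≤ w x≤y)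
... | false | _       | false | _       = countLeq-mono-≤ w x≤y

countLeq-mono-< : ∀ w {x y} → x < y → y ∈ w → countLeq x w < countLeq y w
countLeq-mono-< (z ∷ w) {x} {y} x<y y∈ with z ≤ᵇ x | ≤ᵇ-reflects-≤ z x | z ≤ᵇ y | ≤ᵇ-reflects-≤ z y | y∈
... | true  | ofʸ z≤x | true  | _       | here refl = contradiction z≤x (<⇒≱ x<y)
... | true  | _       | true  | _       | there y∈w = s≤s (countLeq-mono-< w x<y y∈w)
... | true  | ofʸ z≤x | false | ofⁿ z≰y | _         = contradiction (≤-trans z≤x (<⇒≤ x<y)) z≰y
... | false | _       | true  | _       | here refl = s≤s (countLeq-mono-≤ w (<⇒≤ x<y))
... | false | _       | true  | _       | there y∈w = m≤n⇒m≤1+n (countLeq-mono-< w x<y y∈w)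
... | _     | _       | false | ofⁿ z≰y | here refl = contradiction ≤-refl z≰y
... | false | _       | false | _       | there y∈w = countLeq-mono-< w x<y y∈w

rank-sameOrder : ∀ w {x y} → x ∈ w → y ∈ w → SameOrder (x , rank w x) (y , rank w y)
rank-sameOrder w {x} {y} x∈w y∈w = countLeq-mono-≤ w , rank-reflects-≤
  where
  rank-reflects-≤ : rank w x ≤ rank w y → x ≤ y
  rank-reflects-≤ r≤ with x ≤? y
  ... | yes x≤y = x≤y
  ... | no  x≰y = contradiction r≤ (<⇒≱ (countLeq-mono-< w (≰⇒> x≰y) x∈w))

countLeq-matching : ∀ (Y : List (ℕ × ℕ)) a b → (∀ {q} → q ∈ Y → SameOrder q (a , b)) →
                    countLeq a (map proj₁ Y) ≡ countLeq b (map proj₂ Y)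
countLeq-matching [] a b _ = refl
countLeq-matching ((c , d) ∷ Y) a b same with c ≤ᵇ a | ≤ᵇ-reflects-≤ c a | d ≤ᵇ b | ≤ᵇ-reflects-≤ d b
... | true  | _       | true  | _       = cong suc (countLeq-matching Y a b (same ∘ there))
... | true  | ofʸ c≤a | false | ofⁿ d≰b = contradiction (proj₁ (same (here refl)) c≤a) d≰b
... | false | ofⁿ c≰a | true  | ofʸ d≤b = contradiction (proj₂ (same (here refl)) d≤b) c≰a
... | false | _       | false | _       = countLeq-matching Y a b (same ∘ there)

red-compatible : ∀ Z → OrderCompatible Z → red (map proj₁ Z) ≡ red (map proj₂ Z)
red-compatible Z compatible = begin
  map (rank (map proj₁ Z)) (map proj₁ Z)  ≡⟨ map-∘ Z ⟨
  map (rank (map proj₁ Z) ∘ proj₁) Z      ≡⟨ map-cong-local (All.tabulate λ q∈Z →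
                                                countLeq-matching Z _ _ (λ p∈Z → compatible p∈Z q∈Z)) ⟩
  map (rank (map proj₂ Z) ∘ proj₂) Z      ≡⟨ map-∘ Z ⟩
  map (rank (map proj₂ Z)) (map proj₂ Z)  ∎
  where open ≡-Reasoning

occurrence-red : ∀ w → Occurrence w (red w)
occurrence-red w =
  subst (λ s → Occurrence s (red w)) (map-id w) (map-occurrence id (rank w) w (rank-sameOrder w))

red-occurrence : ∀ w → Occurrence (red w) w
red-occurrence w =
  subst (Occurrence (red w)) (map-id w)
        (map-occurrence (rank w) id w (λ x∈ y∈ → swap (rank-sameOrder w x∈ y∈)))

compose : ∀ (Y Z : List (ℕ × ℕ)) → map proj₁ Z ⊆ map proj₂ Y →
          Σ (List (ℕ × ℕ)) λ W → map proj₁ W ⊆ map proj₁ Y × map proj₂ W ≡ map proj₂ Z ×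
                                  (∀ {p} → p ∈ W → Σ ℕ λ b → (proj₁ p , b) ∈ Y × (b , proj₂ p) ∈ Z)
compose [] [] [] = [] , [] , refl , λ ()
compose ((a , b) ∷ Y) ((b' , c) ∷ Z) (refl ∷ Z⊆Y) with compose Y Z Z⊆Y
... | W , W⊆Y , W≡Z , via = (a , c) ∷ W , refl ∷ W⊆Y , cong (c ∷_) W≡Z , via'
  where
  via' : ∀ {p} → p ∈ (a , c) ∷ W → ∃[ b₀ ] ((proj₁ p , b₀) ∈ (a , b) ∷ Y × (b₀ , proj₂ p) ∈ (b , c) ∷ Z)
  via' (here refl) = b , here refl , here refl
  via' (there p∈W) = let b₀ , i , j = via p∈W in b₀ , there i , there j
compose (y ∷ Y) Z (_ ∷ʳ Z⊆Y) with compose Y Z Z⊆Y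
... | W , W⊆Y , W≡Z , via = W , proj₁ y ∷ʳ W⊆Y , W≡Z , λ p∈W → let b , i , j = via p∈W in b , there i , j

occurrence-trans : ∀ {σ w v} → Occurrence σ w → Occurrence w v → Occurrence σ v
occurrence-trans (occurrence Y Y⊆σ refl Yc) (occurrence Z Z⊆Y Z≡v Zc) with compose Y Z Z⊆Y
... | W , W⊆Y , W≡Z , via = occurrence W (⊆-trans W⊆Y Y⊆σ) (trans W≡Z Z≡v) compatible
  where
  compatible : OrderCompatible W
  compatible p∈W q∈W with via p∈W | via q∈W
  ... | _ , pY , pZ | _ , qY , qZ = SameOrder-trans (Yc pY qY) (Zc pZ qZ)

occurrence⇒Contains : ∀ {σ w} → Occurrence σ w → Contains σ w
occurrence⇒Contains (occurrence Z Z⊆σ refl c) = map proj₁ Z , Z⊆σ , red-compatible Z c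

Contains⇒occurrence : ∀ {σ w} → Contains σ w → Occurrence σ w
Contains⇒occurrence {w = w} (u , u⊆σ , red≡) =
  Occurrence-⊆ u⊆σ
    (occurrence-trans (occurrence-red u) (subst (λ r → Occurrence r w) (sym red≡) (red-occurrence w)))

Contains-[] : ∀ σ → Contains σ []
Contains-[] σ = [] , []⊆-universal σ , refl

⊆⇒Contains : ∀ {v w} → v ⊆ w → Contains w v
⊆⇒Contains {v} v⊆w = v , v⊆w , refl

Contains-⊆ : ∀ {σ σ' w} → σ ⊆ σ' → Contains σ w → Contains σ' w
Contains-⊆ σ⊆σ' (u , u⊆σ , red≡) = u , ⊆-trans u⊆σ σ⊆σ' , red≡

Contains-trans : ∀ {σ w v} → Contains σ w → Contains w v → Contains σ v
Contains-trans σ⊇w w⊇v =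
  occurrence⇒Contains (occurrence-trans (Contains⇒occurrence σ⊇w) (Contains⇒occurrence w⊇v))

Contains-red⁺ : ∀ {σ w} → Contains σ w → Contains σ (red w)
Contains-red⁺ {w = w} σ⊇w = Contains-trans σ⊇w (occurrence⇒Contains (occurrence-red w))

Contains-red⁻ : ∀ {σ w} → Contains σ (red w) → Contains σ w
Contains-red⁻ {w = w} σ⊇rw = Contains-trans σ⊇rw (occurrence⇒Contains (red-occurrence w))

∃-sublist? : {P : List ℕ → Set} → (∀ u → Dec (P u)) → ∀ xs → Dec (∃[ u ] (u ⊆ xs × P u))
∃-sublist? P? [] with P? []
... | yes p = yes ([] , [] , p)
... | no ¬p = no λ { (_ , [] , p) → ¬p p }
∃-sublist? P? (x ∷ xs) with ∃-sublist? P? xs | ∃-sublist? (P? ∘ (x ∷_)) xs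
... | yes (u , u⊆xs , p) | _                    = yes (u , x ∷ʳ u⊆xs , p)
... | no _               | yes (u , u⊆xs , p) = yes (x ∷ u , refl ∷ u⊆xs , p)
... | no ¬skip           | no ¬keep             =
  no λ { (u , (_ ∷ʳ u⊆xs) , p) → ¬skip (u , u⊆xs , p) ; (_ ∷ u , (refl ∷ u⊆xs) , p) → ¬keep (u , u⊆xs , p) }

Contains? : ∀ σ w → Dec (Contains σ w)
Contains? σ w = ∃-sublist? (λ u → ≡-dec _≟_ (red u) (red w)) σ

threshold : {D : ℕ → Set} → (∀ j → Dec (D j)) → D 0 → ∀ m → ¬ D m → ∃[ i ] (i < m × D i × ¬ D (suc i))
threshold D? D0 zero ¬D0 = contradiction D0 ¬D0
threshold D? D0 (suc m) ¬Dsm with D? m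
... | yes Dm  = m , ≤-refl , Dm , ¬Dsm
... | no  ¬Dm = let i , i<m , Di , ¬Dsi = threshold D? D0 m ¬Dm in i , m≤n⇒m≤1+n i<m , Di , ¬Dsi

-- Blocks of the normal form

_≪_ : List ℕ → List ℕ → Set
u ≪ v = ∀ {x y} → x ∈ u → y ∈ v → x < y

isRLMin⇒All< : ∀ x ys → isRLMin x ys ≡ true → All (x <_) ys
isRLMin⇒All< x [] _ = []
isRLMin⇒All< x (y ∷ ys) rl with x <ᵇ y | <ᵇ-reflects-< x y
... | true  | ofʸ x<y = x<y ∷ isRLMin⇒All< x ys rl
isRLMin⇒All< x (y ∷ ys) () | false | _

All<⇒isRLMin : ∀ x ys → All (x <_) ys → isRLMin x ys ≡ true
All<⇒isRLMin x [] [] = refl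
All<⇒isRLMin x (y ∷ ys) (x<y ∷ x<ys) with x <ᵇ y | <ᵇ-reflects-< x y
... | true  | _       = All<⇒isRLMin x ys x<ys
... | false | ofⁿ x≮y = contradiction x<y x≮y

reverse-∷-++ : ∀ (x : ℕ) acc ys → reverse (x ∷ acc) ++ ys ≡ reverse acc ++ x ∷ ys
reverse-∷-++ x acc ys = trans (cong (_++ ys) (unfold-reverse x acc)) (++-assoc (reverse acc) (x ∷ []) ys)

concat-blocksAux : ∀ acc x xs → concat (blocksAux acc (x ∷ xs)) ≡ reverse acc ++ x ∷ xs
concat-blocksAux acc x [] = trans (++-identityʳ _) (unfold-reverse x acc)
concat-blocksAux acc x (y ∷ ys) with isRLMin x (y ∷ ys)
... | true  = trans (cong (reverse (x ∷ acc) ++_) (concat-blocksAux [] y ys)) (reverse-∷-++ x acc _)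
... | false = trans (concat-blocksAux (x ∷ acc) y ys) (reverse-∷-++ x acc _)

concat-blocks : ∀ τ → concat (blocks τ) ≡ τ
concat-blocks [] = refl
concat-blocks (x ∷ xs) = concat-blocksAux [] x xs

concat-take-++-concat-drop : ∀ j (xss : List (List ℕ)) →
                             concat (take j xss) ++ concat (drop j xss) ≡ concat xss
concat-take-++-concat-drop j xss =
  trans (concat-++ (take j xss) (drop j xss)) (cong concat (take++drop≡id j xss))

concat⁺ : ∀ {xss yss : List (List ℕ)} → xss ⊆ yss → concat xss ⊆ concat yss
concat⁺ [] = []
concat⁺ (ys ∷ʳ xss⊆yss) = ++⁺ˡ ys (concat⁺ xss⊆yss)
concat⁺ (refl ∷ xss⊆yss) = ++⁺ ⊆-refl (concat⁺ xss⊆yss)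

blockSuffix : ℕ → List ℕ → List ℕ
blockSuffix j τ = concat (drop j (blocks τ))

prefixTo-++-blockSuffix : ∀ j τ → prefixTo j τ ++ blockSuffix j τ ≡ τ
prefixTo-++-blockSuffix j τ = trans (concat-take-++-concat-drop j (blocks τ)) (concat-blocks τ)

prefixTo-all : ∀ τ → prefixTo (length (blocks τ)) τ ≡ τ
prefixTo-all τ = trans (cong concat (take-all _ (blocks τ) ≤-refl)) (concat-blocks τ)

prefixTo-mono : ∀ τ {i j} → i ≤ j → prefixTo i τ ⊆ prefixTo j τ
prefixTo-mono τ i≤j = concat⁺ (take⁺ i≤j)

blockSuffix-anti : ∀ τ {i j} → i ≤ j → blockSuffix j τ ⊆ blockSuffix i τ
blockSuffix-anti τ i≤j = concat⁺ (drop⁺-≥ i≤j)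

CutAfterRLMin : List ℕ → List ℕ → Set
CutAfterRLMin u v = u ≡ [] ⊎ ∃[ t ] ∃[ m ] (u ≡ t ++ m ∷ [] × All (m <_) v)

blocksAux-cut : ∀ acc xs j →
  CutAfterRLMin (concat (take j (blocksAux acc xs))) (concat (drop j (blocksAux acc xs)))
blocksAux-cut acc [] zero = inj₁ refl
blocksAux-cut acc [] (suc j) = inj₁ refl
blocksAux-cut acc (x ∷ xs) zero = inj₁ refl
blocksAux-cut acc (x ∷ xs) (suc j) with isRLMin x xs in rl
... | false = blocksAux-cut (x ∷ acc) xs (suc j)
... | true with blocksAux-cut [] xs j
...   | inj₂ (t , m , pre≡ , m<rest) =
  inj₂ (reverse (x ∷ acc) ++ t , m ,
        trans (cong (reverse (x ∷ acc) ++_) pre≡) (sym (++-assoc (reverse (x ∷ acc)) t (m ∷ []))) , m<rest)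
...   | inj₁ pre≡[] =
  inj₂ (reverse acc , x , block≡ , subst (All (x <_)) (sym rest≡xs) (isRLMin⇒All< x xs rl))
  where
  B : List (List ℕ)
  B = blocksAux [] xs
  block≡ : reverse (x ∷ acc) ++ concat (take j B) ≡ reverse acc ++ x ∷ []
  block≡ = trans (cong (reverse (x ∷ acc) ++_) pre≡[]) (trans (++-identityʳ _) (unfold-reverse x acc))
  rest≡xs : concat (drop j B) ≡ xs
  rest≡xs = trans (cong (_++ concat (drop j B)) (sym pre≡[]))
                  (trans (concat-take-++-concat-drop j B) (concat-blocks xs))

blocksAux-prefix-at-RLMin : ∀ acc t x D → isRLMin x D ≡ true →
  ∃[ j ] (concat (take j (blocksAux acc (t ++ x ∷ D))) ≡ reverse acc ++ t ++ x ∷ [])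
blocksAux-prefix-at-RLMin acc [] x D rl rewrite rl = 1 , trans (++-identityʳ _) (unfold-reverse x acc)
blocksAux-prefix-at-RLMin acc (y ∷ t) x D rl with isRLMin y (t ++ x ∷ D)
... | true  = let j , pre≡ = blocksAux-prefix-at-RLMin [] t x D rl
              in suc j , trans (cong (reverse (y ∷ acc) ++_) pre≡) (reverse-∷-++ y acc _)
... | false = let j , pre≡ = blocksAux-prefix-at-RLMin (y ∷ acc) t x D rl
              in j , trans pre≡ (reverse-∷-++ y acc _)

prefixTo-at-cut : ∀ τ u v → τ ≡ u ++ v → u ≪ v → ∃[ j ] (prefixTo j τ ≡ u)
prefixTo-at-cut τ u v τ≡ u≪v with initLast u
... | [] = 0 , refl
... | t ∷ʳ′ m
  with blocksAux-prefix-at-RLMin [] t m v (All<⇒isRLMin m v (All.tabulate (u≪v (∈-++⁺ʳ t (here refl)))))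
... | j , pre≡ =
  j , subst (λ τ' → prefixTo j τ' ≡ t ++ m ∷ []) (sym (trans τ≡ (++-assoc t (m ∷ []) v))) pre≡

-- Avoiding 312

IsPerm⇒Unique : ∀ {n σ} → IsPerm n σ → Unique σ
IsPerm⇒Unique {n} σ↭ =
  Unique-resp-↭ (setoid ℕ) (↭⇒↭ₛ (↭-sym σ↭)) (applyUpTo⁺₁ suc n (λ i<j _ → <⇒≢ i<j ∘ suc-injective))

IsPerm⇒positive : ∀ {n σ x} → IsPerm n σ → x ∈ σ → 1 ≤ x
IsPerm⇒positive σ↭ x∈σ with ∈-applyUpTo⁻ suc (∈-resp-↭ σ↭ x∈σ)
... | _ , _ , refl = s≤s z≤n

Unique-++⇒≢ : ∀ (xs : List ℕ) {ys x y} → Unique (xs ++ ys) → x ∈ xs → y ∈ ys → x ≢ y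
Unique-++⇒≢ (_ ∷ xs) (x≢xs++ys ∷ _) (here refl) y∈ys = All.lookup (All.++⁻ʳ xs x≢xs++ys) y∈ys
Unique-++⇒≢ (_ ∷ xs) (_ ∷ uniq) (there x∈xs) y∈ys = Unique-++⇒≢ xs uniq x∈xs y∈ys

Contains-p312 : ∀ {σ a m b} → a ∷ m ∷ b ∷ [] ⊆ σ → m < b → b < a → Contains σ p312
Contains-p312 {a = a} {m} {b} amb⊆σ m<b b<a =
  occurrence⇒Contains (occurrence ((a , 3) ∷ (m , 1) ∷ (b , 2) ∷ []) amb⊆σ refl compatible)
  where
  m<a : m < a
  m<a = <-trans m<b b<a
  1<2 : 1 < 2
  1<2 = s≤s (s≤s z≤n)
  2<3 : 2 < 3
  2<3 = s≤s 1<2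
  1<3 : 1 < 3
  1<3 = <-trans 1<2 2<3
  compatible : OrderCompatible ((a , 3) ∷ (m , 1) ∷ (b , 2) ∷ [])
  compatible (here refl)                 (here refl)                 = SameOrder-refl
  compatible (here refl)                 (there (here refl))         = SameOrder-> m<a 1<3
  compatible (here refl)                 (there (there (here refl))) = SameOrder-> b<a 2<3
  compatible (there (here refl))         (here refl)                 = SameOrder-< m<a 1<3
  compatible (there (here refl))         (there (here refl))         = SameOrder-refl
  compatible (there (here refl))         (there (there (here refl))) = SameOrder-< m<b 1<2
  compatible (there (there (here refl))) (here refl)                 = SameOrder-< b<a 2<3
  compatible (there (there (here refl))) (there (here refl))         = SameOrder-> m<b 1<2
  compatible (there (there (here refl))) (there (there (here refl))) = SameOrder-refl

-- An entry x > y before the cut and y after it would form the 312-pattern x m y.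
cut-after-RLMin : ∀ t m D → Unique ((t ++ m ∷ []) ++ D) → Avoids ((t ++ m ∷ []) ++ D) p312 →
                  All (m <_) D → (t ++ m ∷ []) ≪ D
cut-after-RLMin t m D uniq av m<D {x} {y} x∈ y∈D with ∈-++⁻ t x∈
... | inj₂ (here refl) = All.lookup m<D y∈D
... | inj₁ x∈t with <-cmp x y
...   | tri< x<y _ _ = x<y
...   | tri≈ _ x≡y _ = contradiction x≡y (Unique-++⇒≢ (t ++ m ∷ []) uniq x∈ y∈D)
...   | tri> _ _ y<x =
  contradiction (Contains-p312 (++⁺ (++⁺ (from∈ x∈t) ⊆-refl) (from∈ y∈D)) (All.lookup m<D y∈D) y<x) av

prefixTo≪blockSuffix : ∀ τ → Unique τ → Avoids τ p312 → ∀ j → prefixTo j τ ≪ blockSuffix j τ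
prefixTo≪blockSuffix τ uniq av j with blocksAux-cut [] τ j
... | inj₁ pre≡[] = λ x∈ _ → case subst (_ ∈_) pre≡[] x∈ of λ ()
... | inj₂ (t , m , pre≡ , m<rest) =
  subst (_≪ blockSuffix j τ) (sym pre≡)
        (cut-after-RLMin t m _ (subst Unique τ≡ uniq) (subst (λ s → Avoids s p312) τ≡ av) m<rest)
  where
  τ≡ : τ ≡ (t ++ m ∷ []) ++ blockSuffix j τ
  τ≡ = trans (sym (prefixTo-++-blockSuffix j τ)) (cong (_++ blockSuffix j τ) pre≡)

cut-after-1 : ∀ {n} u v → IsPerm n (u ++ 1 ∷ v) → Avoids (u ++ 1 ∷ v) p312 → (u ++ 1 ∷ []) ≪ v
cut-after-1 u v perm av = cut-after-RLMin u 1 v uniq (subst (λ s → Avoids s p312) uv≡ av) (All.tabulate 1<y)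
  where
  uv≡ : u ++ 1 ∷ v ≡ (u ++ 1 ∷ []) ++ v
  uv≡ = sym (++-assoc u (1 ∷ []) v)
  uniq : Unique ((u ++ 1 ∷ []) ++ v)
  uniq = subst Unique uv≡ (IsPerm⇒Unique perm)
  1<y : ∀ {y} → y ∈ v → 1 < y
  1<y y∈v = ≤∧≢⇒< (IsPerm⇒positive perm (∈-++⁺ʳ u (there y∈v))) (Unique-++⇒≢ (u ++ 1 ∷ []) uniq (∈-++⁺ʳ u (here refl)) y∈v)

-- Splitting an occurrence along a cut

map-⊆-++ : ∀ {A B : Set} (f : A → B) (P : List B) {D} (Z : List A) → map f Z ⊆ P ++ D →
           Σ (List A) λ Z₁ → Σ (List A) λ Z₂ → Z ≡ Z₁ ++ Z₂ × map f Z₁ ⊆ P × map f Z₂ ⊆ D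
map-⊆-++ f [] Z Z⊆D = [] , Z , refl , [] , Z⊆D
map-⊆-++ f (x ∷ P) [] _ = [] , [] , refl , []⊆-universal _ , []⊆-universal _
map-⊆-++ f (x ∷ P) (z ∷ Z) (_ ∷ʳ Z⊆) =
  let Z₁ , Z₂ , Z≡ , Z₁⊆P , Z₂⊆D = map-⊆-++ f P (z ∷ Z) Z⊆ in Z₁ , Z₂ , Z≡ , x ∷ʳ Z₁⊆P , Z₂⊆D
map-⊆-++ f (x ∷ P) (z ∷ Z) (fz≡x ∷ Z⊆) =
  let Z₁ , Z₂ , Z≡ , Z₁⊆P , Z₂⊆D = map-⊆-++ f P Z Z⊆ in z ∷ Z₁ , Z₂ , cong (z ∷_) Z≡ , fz≡x ∷ Z₁⊆P , Z₂⊆D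

occurrence-++⁺ : ∀ {P D u v} → P ≪ D → u ≪ v →
                 Occurrence P u → Occurrence D v → Occurrence (P ++ D) (u ++ v)
occurrence-++⁺ {P} {D} P≪D u≪v (occurrence Y Y⊆P refl Yc) (occurrence Z Z⊆D refl Zc) =
  occurrence (Y ++ Z) (subst (_⊆ P ++ D) (sym (map-++ proj₁ Y Z)) (++⁺ Y⊆P Z⊆D)) (map-++ proj₂ Y Z)
             compatible
  where
  below : ∀ {p q} → p ∈ Y → q ∈ Z → proj₁ p < proj₁ q × proj₂ p < proj₂ q
  below p∈Y q∈Z = P≪D (lookup Y⊆P (∈-map⁺ proj₁ p∈Y)) (lookup Z⊆D (∈-map⁺ proj₁ q∈Z)) ,
                  u≪v (∈-map⁺ proj₂ p∈Y) (∈-map⁺ proj₂ q∈Z)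
  compatible : OrderCompatible (Y ++ Z)
  compatible p∈ q∈ with ∈-++⁻ Y p∈ | ∈-++⁻ Y q∈
  ... | inj₁ p∈Y | inj₁ q∈Y = Yc p∈Y q∈Y
  ... | inj₂ p∈Z | inj₂ q∈Z = Zc p∈Z q∈Z
  ... | inj₁ p∈Y | inj₂ q∈Z = let p₁<q₁ , p₂<q₂ = below p∈Y q∈Z in SameOrder-< p₁<q₁ p₂<q₂
  ... | inj₂ p∈Z | inj₁ q∈Y = let q₁<p₁ , q₂<p₂ = below q∈Y p∈Z in SameOrder-> q₁<p₁ q₂<p₂

occurrence-++⁻ : ∀ {P D w} → P ≪ D → Occurrence (P ++ D) w →
                 ∃[ u ] ∃[ v ] (w ≡ u ++ v × u ≪ v × Occurrence P u × Occurrence D v)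
occurrence-++⁻ {P} P≪D (occurrence Z Z⊆ refl Zc) with map-⊆-++ proj₁ P Z Z⊆
... | Y₁ , Y₂ , refl , Y₁⊆P , Y₂⊆D =
  map proj₂ Y₁ , map proj₂ Y₂ , map-++ proj₂ Y₁ Y₂ , below ,
  occurrence Y₁ Y₁⊆P refl (λ p∈ q∈ → Zc (∈-++⁺ˡ p∈) (∈-++⁺ˡ q∈)) ,
  occurrence Y₂ Y₂⊆D refl (λ p∈ q∈ → Zc (∈-++⁺ʳ Y₁ p∈) (∈-++⁺ʳ Y₁ q∈))
  where
  below : map proj₂ Y₁ ≪ map proj₂ Y₂
  below b∈ d∈ with ∈-map⁻ proj₂ b∈ | ∈-map⁻ proj₂ d∈
  ... | p , p∈Y₁ , refl | q , q∈Y₂ , refl =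
    ≰⇒> λ q₂≤p₂ → <⇒≱ (P≪D (lookup Y₁⊆P (∈-map⁺ proj₁ p∈Y₁)) (lookup Y₂⊆D (∈-map⁺ proj₁ q∈Y₂)))
                       (proj₂ (Zc (∈-++⁺ʳ Y₁ q∈Y₂) (∈-++⁺ˡ p∈Y₁)) q₂≤p₂)

BlockwiseContains : List ℕ → List ℕ → List ℕ → Set
BlockwiseContains P D τ = ∃[ j ] (Contains P (prefixTo j τ) × Contains D (blockSuffix j τ))

Contains-++-blocks : ∀ {P D τ} → P ≪ D → (∀ j → prefixTo j τ ≪ blockSuffix j τ) →
                     Contains (P ++ D) τ ⇔ BlockwiseContains P D τ
Contains-++-blocks {P} {D} {τ} P≪D τ-cut = mk⇔ split join
  where
  join : BlockwiseContains P D τ → Contains (P ++ D) τ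
  join (j , P⊇ , D⊇) = occurrence⇒Contains (subst (Occurrence (P ++ D)) (prefixTo-++-blockSuffix j τ)
    (occurrence-++⁺ P≪D (τ-cut j) (Contains⇒occurrence P⊇) (Contains⇒occurrence D⊇)))
  split : Contains (P ++ D) τ → BlockwiseContains P D τ
  split P++D⊇τ with occurrence-++⁻ P≪D (Contains⇒occurrence P++D⊇τ)
  ... | u , v , τ≡ , u≪v , P⊇u , D⊇v with prefixTo-at-cut τ u v τ≡ u≪v
  ... | j , pre≡u = j , occurrence⇒Contains (subst (Occurrence P) (sym pre≡u) P⊇u)
                      , occurrence⇒Contains (subst (Occurrence D) (sym suf≡v) D⊇v)
    where
    suf≡v : blockSuffix j τ ≡ v
    suf≡v = ++-cancelˡ u (blockSuffix j τ) v
              (trans (cong (_++ blockSuffix j τ) (sym pre≡u)) (trans (prefixTo-++-blockSuffix j τ) τ≡))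

lemma2p1 : (k : ℕ) → 1 ≤ k → (τ : List ℕ) → IsPerm k τ → Avoids τ p312 →
             (n : ℕ) → 1 ≤ n → (σ : List ℕ) → IsPerm n σ → Avoids σ p312 →
             (σ' σ'' : List ℕ) → σ ≡ σ' ++ 1 ∷ σ'' →
             (Avoids σ τ ⇔
               (∃[ i ] (i < length (blocks τ)
                 × Avoids (σ' ++ 1 ∷ []) (prefixTo (suc i) τ)
                 × Contains (σ' ++ 1 ∷ []) (prefixTo i τ)
                 × Avoids σ'' (suffix i τ))))
lemma2p1 _ _ τ τ-perm τ-av _ _ _ σ-perm σ-av σ' σ'' refl = mk⇔ avoids⇒threshold threshold⇒avoids
  where
  P : List ℕ
  P = σ' ++ 1 ∷ []
  σ≡P++σ'' : σ' ++ 1 ∷ σ'' ≡ P ++ σ''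
  σ≡P++σ'' = sym (++-assoc σ' (1 ∷ []) σ'')
  σ⊇τ⇔ : Contains (σ' ++ 1 ∷ σ'') τ ⇔ BlockwiseContains P σ'' τ
  σ⊇τ⇔ = subst (λ s → Contains s τ ⇔ BlockwiseContains P σ'' τ) (sym σ≡P++σ'')
           (Contains-++-blocks (cut-after-1 σ' σ'' σ-perm σ-av)
                               (prefixTo≪blockSuffix τ (IsPerm⇒Unique τ-perm) τ-av))
  open Equivalence σ⊇τ⇔ using (to; from)

  Threshold : Set
  Threshold = ∃[ i ] (i < length (blocks τ) × Avoids P (prefixTo (suc i) τ) × Contains P (prefixTo i τ)
                      × Avoids σ'' (suffix i τ))

  avoids⇒threshold : Avoids (σ' ++ 1 ∷ σ'') τ → Threshold
  avoids⇒threshold av =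
    let i , i<r , P⊇Θᵢ₋₁ , P⊉Θᵢ =
          threshold (λ j → Contains? P (prefixTo j τ)) (Contains-[] P) (length (blocks τ)) P⊉τ
    in i , i<r , P⊉Θᵢ , P⊇Θᵢ₋₁ , λ σ''⊇ → av (from (i , P⊇Θᵢ₋₁ , Contains-red⁻ σ''⊇))
    where
    P⊉τ : ¬ Contains P (prefixTo (length (blocks τ)) τ)
    P⊉τ P⊇τ = av (Contains-⊆ (subst (P ⊆_) (sym σ≡P++σ'') (++⁺ʳ σ'' ⊆-refl))
                             (subst (Contains P) (prefixTo-all τ) P⊇τ))

  threshold⇒avoids : Threshold → Avoids (σ' ++ 1 ∷ σ'') τ
  threshold⇒avoids (i , _ , P⊉Θᵢ , _ , σ''⊉suffix) σ⊇τ with to σ⊇τ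
  ... | j , P⊇Θⱼ₋₁ , σ''⊇ with j ≤? i
  ...   | yes j≤i = σ''⊉suffix (Contains-red⁺ (Contains-trans σ''⊇ (⊆⇒Contains (blockSuffix-anti τ j≤i))))
  ...   | no  j≰i = P⊉Θᵢ (Contains-trans P⊇Θⱼ₋₁ (⊆⇒Contains (prefixTo-mono τ (≰⇒> j≰i))))
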